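{- Let $p(x),q(x)\in\mathbb{Z}[x]$ with $\deg p(x)>\deg q(x)$ and $q(0)=0$. Suppose $a\in\mathbb{Q}$ is such that $\frac{p(a)}{q(a)}\in\mathbb{Z}$ (in particular $q(a)\neq 0$). Write $a=\frac{r}{s}$ in lowest terms and $p(x)=\sum_{i=0}^n p_ix^i$ with $p_n\neq 0$. Then $s\mid p_n$ and $r\mid p_0$. -}

module Defs where

open import Data.Nat using (ℕ; zero; suc)
open import Data.Fin using (Fin; zero; suc)
open import Data.Integer using (ℤ)
open import Data.Rational using (ℚ; 0ℚ; _+_; _*_; _/_)

ℤ→ℚ : ℤ → ℚ
ℤ→ℚ z = z / 1

-- A polynomial with integer coefficients of formal length m is given by its
-- coefficient function c : Fin m → ℤ, where c i is the coefficient of x^i.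
eval : {m : ℕ} → (Fin m → ℤ) → ℚ → ℚ
eval {zero}  c x = 0ℚ
eval {suc m} c x = ℤ→ℚ (c zero) + x * eval (λ i → c (suc i)) x

{-# OPTIONS --safe #-}
-- With a = r/s in lowest terms and deg p ≤ n, the homogenisation
-- P(r,s) = Σ pᵢ rⁱ sⁿ⁻ⁱ equals sⁿ p(a), and likewise Q(r,s) = sⁿ⁻¹ q(a).
-- So p(a) = k q(a) becomes the integer identity P(r,s) = k s Q(r,s).
-- Modulo s, P(r,s) ≡ pₙ rⁿ; modulo r, P(r,s) ≡ p₀ sⁿ, and Q(r,s) ≡ 0 since
-- q(0) = 0. Hence s ∣ pₙ rⁿ and r ∣ p₀ sⁿ, and coprimality of r and s finishes.
module Submission where

open import Defs
open import Data.Nat using (ℕ; suc; zero)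
open import Data.Fin using (Fin; zero; fromℕ; suc)
open import Data.Integer using (ℤ; +_; _^_)
import Data.Integer as ℤ
import Data.Integer.Properties as ℤ
open import Data.Integer.Coprimality using (Coprime; coprime-divisor)
import Data.Integer.Coprimality as Coprime
open import Data.Integer.Divisibility using (_∣_)
import Data.Integer.Divisibility.Signed as Signed
open Signed using (divides; ∣⇒∣ᵤ; ∣m∣n⇒∣m+n; ∣n⇒∣m*n; ∣m⇒∣m*n; ∣m+n∣n⇒∣m; ∣-refl)
  renaming (_∣_ to _∣ˢ_)
open import Data.Integer.Tactic.RingSolver using (solve-∀)
import Data.Nat.Coprimality as ℕ
open import Data.Rational using (ℚ; mkℚ; ↥_; ↧_; 0ℚ; 1ℚ; _+_; _*_; toℚᵘ)
open import Data.Rational.Properties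
  using (toℚᵘ-injective; toℚᵘ-cong; toℚᵘ-fromℚᵘ; toℚᵘ-homo-+; toℚᵘ-homo-*; *-zeroˡ; +-identityʳ)
open import Data.Rational.Solver using (module +-*-Solver)
open import Data.Rational.Unnormalised using (mkℚᵘ; *≡*) renaming (_≃_ to _≃ᵘ_; _+_ to _+ᵘ_; _*_ to _*ᵘ_)
import Data.Rational.Unnormalised.Properties as ℚᵘ
open import Data.Vec.Functional using (tail)
open import Data.Product using (∃; ∃-syntax; _×_; _,_)
open import Data.Empty using (⊥-elim)
open import Relation.Binary.PropositionalEquality
  using (_≡_; _≢_; refl; sym; trans; cong; cong₂; subst; module ≡-Reasoning)

-- ℤ→ℚ z is definitionally fromℚᵘ (mkℚᵘ z 0).
toℚᵘ-ℤ→ℚ : ∀ z → toℚᵘ (ℤ→ℚ z) ≃ᵘ mkℚᵘ z 0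
toℚᵘ-ℤ→ℚ z = toℚᵘ-fromℚᵘ (mkℚᵘ z 0)

ℤ→ℚ-homo-+ : ∀ x y → ℤ→ℚ (x ℤ.+ y) ≡ ℤ→ℚ x + ℤ→ℚ y
ℤ→ℚ-homo-+ x y = toℚᵘ-injective (begin
  toℚᵘ (ℤ→ℚ (x ℤ.+ y))          ≈⟨ toℚᵘ-ℤ→ℚ (x ℤ.+ y) ⟩
  mkℚᵘ (x ℤ.+ y) 0              ≈⟨ *≡* (cross-multiplied x y) ⟩
  mkℚᵘ x 0 +ᵘ mkℚᵘ y 0          ≈⟨ ℚᵘ.+-cong (toℚᵘ-ℤ→ℚ x) (toℚᵘ-ℤ→ℚ y) ⟨
  toℚᵘ (ℤ→ℚ x) +ᵘ toℚᵘ (ℤ→ℚ y)  ≈⟨ toℚᵘ-homo-+ (ℤ→ℚ x) (ℤ→ℚ y) ⟨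
  toℚᵘ (ℤ→ℚ x + ℤ→ℚ y)          ∎)
  where
  open ℚᵘ.≃-Reasoning
  cross-multiplied : ∀ x y → (x ℤ.+ y) ℤ.* + 1 ≡ (x ℤ.* + 1 ℤ.+ y ℤ.* + 1) ℤ.* + 1
  cross-multiplied = solve-∀

ℤ→ℚ-homo-* : ∀ x y → ℤ→ℚ (x ℤ.* y) ≡ ℤ→ℚ x * ℤ→ℚ y
ℤ→ℚ-homo-* x y = toℚᵘ-injective (begin
  toℚᵘ (ℤ→ℚ (x ℤ.* y))          ≈⟨ toℚᵘ-ℤ→ℚ (x ℤ.* y) ⟩
  mkℚᵘ x 0 *ᵘ mkℚᵘ y 0          ≈⟨ ℚᵘ.*-cong (toℚᵘ-ℤ→ℚ x) (toℚᵘ-ℤ→ℚ y) ⟨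
  toℚᵘ (ℤ→ℚ x) *ᵘ toℚᵘ (ℤ→ℚ y)  ≈⟨ toℚᵘ-homo-* (ℤ→ℚ x) (ℤ→ℚ y) ⟨
  toℚᵘ (ℤ→ℚ x * ℤ→ℚ y)          ∎)
  where open ℚᵘ.≃-Reasoning

ℤ→ℚ-injective : ∀ x y → ℤ→ℚ x ≡ ℤ→ℚ y → x ≡ y
ℤ→ℚ-injective x y eq = begin
  x          ≡⟨ ℤ.*-identityʳ x ⟨
  x ℤ.* + 1  ≡⟨ ℚᵘ.drop-*≡* x≃y ⟩
  y ℤ.* + 1  ≡⟨ ℤ.*-identityʳ y ⟩
  y          ∎
  where
  open ≡-Reasoning
  x≃y : mkℚᵘ x 0 ≃ᵘ mkℚᵘ y 0
  x≃y = ℚᵘ.≃-trans (ℚᵘ.≃-sym (toℚᵘ-ℤ→ℚ x)) (ℚᵘ.≃-trans (toℚᵘ-cong eq) (toℚᵘ-ℤ→ℚ y))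

ℤ→ℚ-↥p≡p*ℤ→ℚ-↧p : ∀ p → ℤ→ℚ (↥ p) ≡ p * ℤ→ℚ (↧ p)
ℤ→ℚ-↥p≡p*ℤ→ℚ-↧p p@record{} = toℚᵘ-injective (begin
  toℚᵘ (ℤ→ℚ (↥ p))            ≈⟨ toℚᵘ-ℤ→ℚ (↥ p) ⟩
  mkℚᵘ (↥ p) 0                ≈⟨ *≡* (cross-multiplied (↥ p) (↧ p)) ⟩
  toℚᵘ p *ᵘ mkℚᵘ (↧ p) 0      ≈⟨ ℚᵘ.*-congˡ {toℚᵘ p} (toℚᵘ-ℤ→ℚ (↧ p)) ⟨
  toℚᵘ p *ᵘ toℚᵘ (ℤ→ℚ (↧ p))  ≈⟨ toℚᵘ-homo-* p (ℤ→ℚ (↧ p)) ⟨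
  toℚᵘ (p * ℤ→ℚ (↧ p))        ∎)
  where
  open ℚᵘ.≃-Reasoning
  cross-multiplied : ∀ n d → n ℤ.* (d ℤ.* + 1) ≡ (n ℤ.* d) ℤ.* + 1
  cross-multiplied = solve-∀

↥p-↧p-coprime : ∀ p → Coprime (↥ p) (↧ p)
↥p-↧p-coprime (mkℚ _ _ coprime) = ℕ.recompute coprime

eval-at-0ℚ : ∀ {m} (c : Fin (suc m) → ℤ) → eval c 0ℚ ≡ ℤ→ℚ (c zero)
eval-at-0ℚ c = begin
  ℤ→ℚ (c zero) + 0ℚ * eval (tail c) 0ℚ  ≡⟨ cong (λ t → ℤ→ℚ (c zero) + t) (*-zeroˡ (eval (tail c) 0ℚ)) ⟩
  ℤ→ℚ (c zero) + 0ℚ                     ≡⟨ +-identityʳ (ℤ→ℚ (c zero)) ⟩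
  ℤ→ℚ (c zero)                          ∎
  where open ≡-Reasoning

homogenise : ∀ {m} → (Fin (suc m) → ℤ) → ℤ → ℤ → ℤ
homogenise {zero}  c r s = c zero
homogenise {suc m} c r s = c zero ℤ.* s ^ suc m ℤ.+ r ℤ.* homogenise (tail c) r s

homogenise-constant : ∀ {m} (c : Fin (suc m) → ℤ) r s →
                      ∃[ y ] homogenise c r s ≡ c zero ℤ.* s ^ m ℤ.+ r ℤ.* y
homogenise-constant {zero}  c r s = + 0 , c₀≡c₀*1+r*0 (c zero) r
  where
  c₀≡c₀*1+r*0 : ∀ c₀ r → c₀ ≡ c₀ ℤ.* + 1 ℤ.+ r ℤ.* + 0
  c₀≡c₀*1+r*0 = solve-∀
homogenise-constant {suc m} c r s = homogenise (tail c) r s , refl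

homogenise-leading : ∀ {m} (c : Fin (suc m) → ℤ) r s →
                     ∃[ y ] homogenise c r s ≡ c (fromℕ m) ℤ.* r ^ m ℤ.+ s ℤ.* y
homogenise-leading {zero}  c r s = + 0 , c₀≡c₀*1+s*0 (c zero) s
  where
  c₀≡c₀*1+s*0 : ∀ c₀ s → c₀ ≡ c₀ ℤ.* + 1 ℤ.+ s ℤ.* + 0
  c₀≡c₀*1+s*0 = solve-∀
homogenise-leading {suc m} c r s with homogenise-leading (tail c) r s
... | y , eq = c zero ℤ.* s ^ m ℤ.+ r ℤ.* y ,
  trans (cong (λ h → c zero ℤ.* s ^ suc m ℤ.+ r ℤ.* h) eq)
        (regroup (c zero) s (s ^ m) r (c (fromℕ (suc m))) (r ^ m) y)
  where
  regroup : ∀ c₀ s sᵐ r cₘ rᵐ y →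
            c₀ ℤ.* (s ℤ.* sᵐ) ℤ.+ r ℤ.* (cₘ ℤ.* rᵐ ℤ.+ s ℤ.* y)
            ≡ cₘ ℤ.* (r ℤ.* rᵐ) ℤ.+ s ℤ.* (c₀ ℤ.* sᵐ ℤ.+ r ℤ.* y)
  regroup = solve-∀

module _ {a : ℚ} {r s : ℤ} (r≡a*s : ℤ→ℚ r ≡ a * ℤ→ℚ s) where

  homogenise-eval : ∀ {m} (c : Fin (suc m) → ℤ) →
                    ℤ→ℚ (homogenise c r s) ≡ ℤ→ℚ (s ^ m) * eval c a
  homogenise-eval {zero} c = solve 2 (λ c₀ a → c₀ := con 1ℚ :* (c₀ :+ a :* con 0ℚ)) refl (ℤ→ℚ (c zero)) a
    where open +-*-Solver
  homogenise-eval {suc m} c = begin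
    ℤ→ℚ (c zero ℤ.* s ^ suc m ℤ.+ r ℤ.* homogenise (tail c) r s)
      ≡⟨ ℤ→ℚ-homo-+ (c zero ℤ.* s ^ suc m) (r ℤ.* homogenise (tail c) r s) ⟩
    ℤ→ℚ (c zero ℤ.* (s ℤ.* s ^ m)) + ℤ→ℚ (r ℤ.* homogenise (tail c) r s)
      ≡⟨ cong₂ _+_ (trans (ℤ→ℚ-homo-* (c zero) _) (cong (ℤ→ℚ (c zero) *_) (ℤ→ℚ-homo-* s (s ^ m))))
                   (trans (ℤ→ℚ-homo-* r _) (cong₂ _*_ r≡a*s (homogenise-eval (tail c)))) ⟩
    C * (S * M) + (a * S) * (M * E)
      ≡⟨ factor C S M a E ⟩
    (S * M) * (C + a * E)
      ≡⟨ cong (_* eval c a) (ℤ→ℚ-homo-* s (s ^ m)) ⟨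
    ℤ→ℚ (s ^ suc m) * eval c a
      ∎
    where
    open ≡-Reasoning
    C = ℤ→ℚ (c zero)
    S = ℤ→ℚ s
    M = ℤ→ℚ (s ^ m)
    E = eval (tail c) a
    factor : ∀ C S M a E → C * (S * M) + (a * S) * (M * E) ≡ (S * M) * (C + a * E)
    factor = solve 5 (λ C S M a E → C :* (S :* M) :+ (a :* S) :* (M :* E) := (S :* M) :* (C :+ a :* E)) refl
      where open +-*-Solver

  homogenise-proportional : ∀ {m} (p : Fin (suc (suc m)) → ℤ) (q : Fin (suc m) → ℤ) k →
                            eval p a ≡ ℤ→ℚ k * eval q a →
                            homogenise p r s ≡ k ℤ.* s ℤ.* homogenise q r s
  homogenise-proportional {m} p q k p[a]≡k*q[a] = ℤ→ℚ-injective _ _ (begin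
    ℤ→ℚ (homogenise p r s)                  ≡⟨ homogenise-eval p ⟩
    ℤ→ℚ (s ℤ.* s ^ m) * eval p a            ≡⟨ cong₂ _*_ (ℤ→ℚ-homo-* s (s ^ m)) p[a]≡k*q[a] ⟩
    (S * M) * (K * eval q a)                ≡⟨ regroup S M K (eval q a) ⟩
    (K * S) * (M * eval q a)                ≡⟨ cong₂ _*_ (ℤ→ℚ-homo-* k s) (homogenise-eval q) ⟨
    ℤ→ℚ (k ℤ.* s) * ℤ→ℚ (homogenise q r s)  ≡⟨ ℤ→ℚ-homo-* (k ℤ.* s) (homogenise q r s) ⟨
    ℤ→ℚ (k ℤ.* s ℤ.* homogenise q r s)      ∎)
    where
    open ≡-Reasoning
    S = ℤ→ℚ s
    M = ℤ→ℚ (s ^ m)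
    K = ℤ→ℚ k
    regroup : ∀ S M K Q → (S * M) * (K * Q) ≡ (K * S) * (M * Q)
    regroup = solve 4 (λ S M K Q → (S :* M) :* (K :* Q) := (K :* S) :* (M :* Q)) refl
      where open +-*-Solver

coprime-divisor-^ : ∀ i j k m → Coprime i j → i ∣ j ^ m ℤ.* k → i ∣ k
coprime-divisor-^ i j k zero    _       i∣1*k  = subst (i ∣_) (ℤ.*-identityˡ k) i∣1*k
coprime-divisor-^ i j k (suc m) coprime i∣jʲk =
  coprime-divisor-^ i j k m coprime
    (coprime-divisor i j (j ^ m ℤ.* k) coprime (subst (i ∣_) (ℤ.*-assoc j (j ^ m) k) i∣jʲk))

∣k*j^m+i*z⇒∣k : ∀ {i j} k m z → Coprime i j → i ∣ˢ k ℤ.* j ^ m ℤ.+ i ℤ.* z → i ∣ k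
∣k*j^m+i*z⇒∣k {i} {j} k m z coprime i∣kjᵐ+iz =
  coprime-divisor-^ i j k m coprime
    (subst (i ∣_) (ℤ.*-comm k (j ^ m)) (∣⇒∣ᵤ (∣m+n∣n⇒∣m {i} {k ℤ.* j ^ m} i∣kjᵐ+iz (∣m⇒∣m*n z ∣-refl))))

∣c₀⇒∣homogenise : ∀ {m} (c : Fin (suc m) → ℤ) r s → r ∣ˢ c zero → r ∣ˢ homogenise c r s
∣c₀⇒∣homogenise {m} c r s r∣c₀ with homogenise-constant c r s
... | y , H≡c₀sᵐ+ry = subst (r ∣ˢ_) (sym H≡c₀sᵐ+ry) (∣m∣n⇒∣m+n (∣m⇒∣m*n (s ^ m) r∣c₀) (∣m⇒∣m*n y ∣-refl))

∣homogenise⇒∣leading : ∀ {m} (c : Fin (suc m) → ℤ) {r s} →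
                       Coprime s r → s ∣ˢ homogenise c r s → s ∣ c (fromℕ m)
∣homogenise⇒∣leading {m} c {r} {s} coprime s∣H with homogenise-leading c r s
... | y , H≡cₘrᵐ+sy = ∣k*j^m+i*z⇒∣k {s} {r} (c (fromℕ m)) m y coprime (subst (s ∣ˢ_) H≡cₘrᵐ+sy s∣H)

∣homogenise⇒∣constant : ∀ {m} (c : Fin (suc m) → ℤ) {r s} →
                        Coprime r s → r ∣ˢ homogenise c r s → r ∣ c zero
∣homogenise⇒∣constant {m} c {r} {s} coprime r∣H with homogenise-constant c r s
... | y , H≡c₀sᵐ+ry = ∣k*j^m+i*z⇒∣k {r} {s} (c zero) m y coprime (subst (r ∣ˢ_) H≡c₀sᵐ+ry r∣H)

lemma5p4 : (n : ℕ) (p : Fin (suc n) → ℤ) (q : Fin n → ℤ) (a : ℚ)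
    → p (fromℕ n) ≢ + 0
    → eval q 0ℚ ≡ 0ℚ
    → eval q a ≢ 0ℚ
    → ∃ (λ (k : ℤ) → eval p a ≡ ℤ→ℚ k * eval q a)
    → ((↧ a) ∣ p (fromℕ n)) × ((↥ a) ∣ p zero)
lemma5p4 zero    p q a _ _       q[a]≢0 _                 = ⊥-elim (q[a]≢0 refl)
lemma5p4 (suc m) p q a _ q[0]≡0 _      (k , p[a]≡k*q[a]) =
  ∣homogenise⇒∣leading p {r} (Coprime.sym {r} {s} coprime) s∣P ,
  ∣homogenise⇒∣constant p {r} coprime r∣P
  where
  r = ↥ a
  s = ↧ a
  coprime : Coprime r s
  coprime = ↥p-↧p-coprime a
  P = homogenise p r s
  Q = homogenise q r s
  P≡ksQ : P ≡ k ℤ.* s ℤ.* Q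
  P≡ksQ = homogenise-proportional {a} (ℤ→ℚ-↥p≡p*ℤ→ℚ-↧p a) p q k p[a]≡k*q[a]
  s∣P : s ∣ˢ P
  s∣P = subst (s ∣ˢ_) (sym P≡ksQ) (∣m⇒∣m*n Q (∣n⇒∣m*n k ∣-refl))
  r∣q₀ : r ∣ˢ q zero
  r∣q₀ = subst (r ∣ˢ_) (ℤ→ℚ-injective (+ 0) (q zero) (trans (sym q[0]≡0) (eval-at-0ℚ q)))
               (divides (+ 0) refl)
  r∣P : r ∣ˢ P
  r∣P = subst (r ∣ˢ_) (sym P≡ksQ) (∣n⇒∣m*n (k ℤ.* s) (∣c₀⇒∣homogenise q r s r∣q₀))
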